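{- Let $k_E$ be a finite field of characteristic $p$ and let $t_1,\ldots,t_d$ be distinct integers in $[0,p]$. Let $X=(x_{i,j})\in\mathrm{Mat}_d(k_E[u])$ be upper triangular with diagonal entries $x_{i,i}=u^{t_i}$ and with $\deg x_{i,j}<t_j$ for all $i<j$, and let $A\in\mathrm{GL}_d(k_E)$. Suppose that for each $i$, $u^{t_i}$ divides every entry of the $i$-th column of $XA$. Then for all $i<j$ we have $x_{i,j}=u^{t_i}y_{i,j}$, where $y_{i,j}=0$ if $t_j<t_i$ and $y_{i,j}\in k_E$ if $t_j>t_i$. -}

module Defs where

open import Level using (Level; _⊔_)
open import Data.Nat as ℕ using (ℕ; zero; suc; _≡ᵇ_)
open import Data.Fin as Fin using (Fin; toℕ)
open import Data.Bool using (if_then_else_)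
open import Data.List using (List)
open import Data.List.Relation.Unary.Any using (Any)
open import Data.Product using (Σ; ∃; _×_)
open import Relation.Nullary using (¬_; does)
open import Algebra.Bundles using (CommutativeRing)

module Over {c ℓ : Level} (R : CommutativeRing c ℓ) where
  open CommutativeRing R

  IsField : Set (c ⊔ ℓ)
  IsField = (¬ (1# ≈ 0#)) × (∀ x → ¬ (x ≈ 0#) → ∃ λ y → (x * y) ≈ 1#)

  IsFinite : Set (c ⊔ ℓ)
  IsFinite = ∃ λ (xs : List Carrier) → ∀ x → Any (x ≈_) xs

  natC : ℕ → Carrier
  natC zero    = 0#
  natC (suc n) = 1# + natC n

  HasChar : ℕ → Set ℓ
  HasChar p = (0 ℕ.< p) × (natC p ≈ 0#) × (∀ n → 0 ℕ.< n → n ℕ.< p → ¬ (natC n ≈ 0#))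

  ΣFin : ∀ {d} → (Fin d → Carrier) → Carrier
  ΣFin {zero}  f = 0#
  ΣFin {suc d} f = f Fin.zero + ΣFin (λ k → f (Fin.suc k))

  ΣUpTo : ℕ → (ℕ → Carrier) → Carrier
  ΣUpTo n f = ΣFin {suc n} (λ i → f (toℕ i))

  -- Polynomials k[u]: coefficient sequences with finite support
  Seq : Set c
  Seq = ℕ → Carrier

  IsPoly : Seq → Set ℓ
  IsPoly f = ∃ λ N → ∀ n → N ℕ.≤ n → f n ≈ 0#

  _≈ₚ_ : Seq → Seq → Set ℓ
  f ≈ₚ g = ∀ n → f n ≈ g n

  0ₚ : Seq
  0ₚ n = 0#

  const : Carrier → Seq
  const a zero    = a
  const a (suc n) = 0#

  u^ : ℕ → Seq
  u^ t n = if n ≡ᵇ t then 1# else 0#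

  _+ₚ_ : Seq → Seq → Seq
  (f +ₚ g) n = f n + g n

  _·ₚ_ : Seq → Seq → Seq
  (f ·ₚ g) n = ΣUpTo n (λ i → f i * g (n ℕ.∸ i))

  _∣ₚ_ : Seq → Seq → Set (c ⊔ ℓ)
  g ∣ₚ f = ∃ λ h → IsPoly h × (f ≈ₚ (g ·ₚ h))

  -- deg f < t   (the zero polynomial has degree -∞)
  DegLt : Seq → ℕ → Set ℓ
  DegLt f t = ∀ n → t ℕ.≤ n → f n ≈ 0#

  Mat : ℕ → Set c
  Mat d = Fin d → Fin d → Carrier

  PMat : ℕ → Set c
  PMat d = Fin d → Fin d → Seq

  _·M_ : ∀ {d} → Mat d → Mat d → Mat d
  (A ·M B) i j = ΣFin (λ k → A i k * B k j)

  idM : ∀ {d} → Mat d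
  idM i j = if does (i Fin.≟ j) then 1# else 0#

  _≈M_ : ∀ {d} → Mat d → Mat d → Set ℓ
  A ≈M B = ∀ i j → A i j ≈ B i j

  IsInvertible : ∀ {d} → Mat d → Set (c ⊔ ℓ)
  IsInvertible {d} A = ∃ λ (B : Mat d) → ((A ·M B) ≈M idM) × ((B ·M A) ≈M idM)

  _·PA_ : ∀ {d} → PMat d → Mat d → PMat d
  (X ·PA A) i j n = ΣFin (λ k → (X i k ·ₚ const (A k j)) n)

module Submission where

-- Write X = Σₙ Xₙ uⁿ with coefficient matrices Xₙ over k and
-- let row i n be the i-th row of Xₙ.  The divisibility hypothesis says,
-- coefficientwise, that (row r n · A)ₗ = 0 whenever n < t l.  We show that
-- row i n = 0 for every n ≠ t i; then every entry of row i of X is a scalar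
-- multiple of u^{t i}, which is the theorem (with y = x_{ij}'s coefficient in
-- degree t i, forced to vanish when t j < t i by deg x_{ij} < t j).
--
-- The key linear-algebra notion is an inverse of A on a set P of indices: a
-- matrix N with Σ_{k ∈ P} A i k N k j = δ i j for i, j ∈ P.  If A has one,
-- a row vector w supported on P with (w A)ₗ = 0 for all l ∈ P vanishes.  By
-- induction on n, A has an inverse on Above n = {k | n ≤ t k}: for n = 0 take
-- A⁻¹; passing from n to n + 1 removes at most one index m (the one with
-- t m = n, by injectivity of t), and the row w = row m (t m), which is
-- supported on Above n, has w m = 1 and kills the other indices of Above n,
-- allows a rank-one correction of the inverse.  Applying the vanishing
-- criterion on Above (n + 1) to w = row i n (for n ≠ t i) finishes the proof.
--
-- The argument does not use that k is a
-- finite field of characteristic p, that t i ≤ p, or that the x_{ij} have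
-- finite support.

open import Defs
open import Data.Nat using (ℕ; _≤_)
open import Data.Fin using (Fin)
open import Data.Product using (∃; _×_)
open import Function.Definitions using (Injective)
open import Relation.Binary.PropositionalEquality using (_≡_)
open import Algebra.Bundles using (CommutativeRing)
import Data.Nat as ℕ
import Data.Fin as F

open import Level using (Level; _⊔_; 0ℓ)
open import Data.Nat using (zero; suc; _<_; _≤?_; _≡ᵇ_; z≤n; s≤s)
import Data.Nat.Properties as ℕP
import Data.Fin.Properties as FinP
open import Data.Fin using (toℕ; fromℕ<; punchIn)
open import Data.Product using (_,_; proj₁; proj₂)
open import Data.Bool using (true; false; T; if_then_else_)
open import Data.Unit using (tt)
open import Function using (_∘_)
open import Data.Vec.Functional using (replicate)
open import Relation.Nullary using (¬_; yes; no; does; contradiction)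
open import Relation.Nullary.Decidable using (_×-dec_; ¬?)
open import Relation.Unary using (Pred; Decidable)
open import Relation.Binary using (tri<; tri≈; tri>)
open import Relation.Binary.PropositionalEquality as ≡ using (_≢_)

module Development {c ℓ : Level} (R : CommutativeRing c ℓ) where
  open CommutativeRing R hiding (zero) renaming (Carrier to K)
  open Over R
  open import Algebra.Properties.Semiring.Sum semiring
    using (sum; sum-cong-≋; sum-replicate-zero; sum-remove;
           ∑-distrib-+; ∑-comm; *-distribˡ-sum; *-distribʳ-sum)
  open import Algebra.Properties.Ring ring using (-‿distribʳ-*)
  open import Algebra.Solver.CommutativeMonoid *-commutativeMonoid using (solve; _⊕_; _⊜_)
  open import Relation.Binary.Reasoning.Setoid setoid

  reassoc : ∀ e x a b → e * ((x * a) * b) ≈ x * (e * (a * b))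
  reassoc = solve 4 (λ e x a b → e ⊕ ((x ⊕ a) ⊕ b) ⊜ x ⊕ (e ⊕ (a ⊕ b))) refl

  split : ∀ e a x y z → e * (a * (x - y * z)) ≈ e * (a * x) + (e * (a * y)) * (- z)
  split e a x y z = begin
    e * (a * (x - y * z))               ≈⟨ *-congˡ (distribˡ a x (- (y * z))) ⟩
    e * (a * x + a * (- (y * z)))       ≈⟨ distribˡ e (a * x) _ ⟩
    e * (a * x) + e * (a * (- (y * z))) ≈⟨ +-congˡ (*-congˡ (*-congˡ (-‿distribʳ-* y z))) ⟩
    e * (a * x) + e * (a * (y * - z))   ≈⟨ +-congˡ (solve 4 (λ e a y w → e ⊕ (a ⊕ (y ⊕ w)) ⊜ (e ⊕ (a ⊕ y)) ⊕ w) refl e a y (- z)) ⟩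
    e * (a * x) + (e * (a * y)) * (- z) ∎

  swap-neg : ∀ a x z g → (a * z) * (- (g * x)) ≈ - ((a * x) * (g * z))
  swap-neg a x z g = trans (sym (-‿distribʳ-* (a * z) (g * x)))
    (-‿cong (solve 4 (λ a x z g → (a ⊕ z) ⊕ (g ⊕ x) ⊜ (a ⊕ x) ⊕ (g ⊕ z)) refl a x z g))

  -- The ΣFin forms of the library facts below are stated because Agda infers
  -- the summands of ΣFin (a definition by pattern matching) but not of sum.
  ΣFin≡sum : ∀ {d} (f : Fin d → K) → ΣFin f ≡ sum f
  ΣFin≡sum {zero}  f = ≡.refl
  ΣFin≡sum {suc d} f = ≡.cong (f F.zero +_) (ΣFin≡sum (f ∘ F.suc))

  ΣFin-cong : ∀ {d} {f g : Fin d → K} → (∀ k → f k ≈ g k) → ΣFin f ≈ ΣFin g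
  ΣFin-cong {f = f} {g} f≈g = begin
    ΣFin f   ≡⟨ ΣFin≡sum f ⟩
    sum f    ≈⟨ sum-cong-≋ {x = f} {y = g} f≈g ⟩
    sum g    ≡⟨ ΣFin≡sum g ⟨
    ΣFin g   ∎

  ΣFin-zero : ∀ {d} {f : Fin d → K} → (∀ k → f k ≈ 0#) → ΣFin f ≈ 0#
  ΣFin-zero {d} {f} f≈0 = begin
    ΣFin f              ≡⟨ ΣFin≡sum f ⟩
    sum f               ≈⟨ sum-cong-≋ {x = f} {y = replicate d 0#} f≈0 ⟩
    sum (replicate d 0#) ≈⟨ sum-replicate-zero d ⟩
    0#                  ∎

  ΣFin-single : ∀ {d} {f : Fin d → K} (m : Fin d) →
                (∀ k → k ≢ m → f k ≈ 0#) → ΣFin f ≈ f m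
  ΣFin-single {suc d} {f} m off = begin
    ΣFin f                         ≡⟨ ΣFin≡sum f ⟩
    sum f                          ≈⟨ sum-remove {i = m} f ⟩
    f m + sum (f ∘ punchIn m)      ≡⟨ ≡.cong (f m +_) (ΣFin≡sum (f ∘ punchIn m)) ⟨
    f m + ΣFin (f ∘ punchIn m)     ≈⟨ +-congˡ (ΣFin-zero (λ k → off (punchIn m k) (FinP.punchInᵢ≢i m k))) ⟩
    f m + 0#                       ≈⟨ +-identityʳ (f m) ⟩
    f m                            ∎

  ΣFin-+ : ∀ {d} (f g : Fin d → K) → ΣFin (λ k → f k + g k) ≈ ΣFin f + ΣFin g
  ΣFin-+ f g = begin
    ΣFin (λ k → f k + g k)   ≡⟨ ΣFin≡sum (λ k → f k + g k) ⟩
    sum (λ k → f k + g k)    ≈⟨ ∑-distrib-+ f g ⟩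
    sum f + sum g            ≡⟨ ≡.cong₂ _+_ (ΣFin≡sum f) (ΣFin≡sum g) ⟨
    ΣFin f + ΣFin g          ∎

  ΣFin-*ˡ : ∀ {d} x (f : Fin d → K) → x * ΣFin f ≈ ΣFin (λ k → x * f k)
  ΣFin-*ˡ x f = begin
    x * ΣFin f              ≡⟨ ≡.cong (x *_) (ΣFin≡sum f) ⟩
    x * sum f               ≈⟨ *-distribˡ-sum x f ⟩
    sum (λ k → x * f k)     ≡⟨ ΣFin≡sum (λ k → x * f k) ⟨
    ΣFin (λ k → x * f k)    ∎

  ΣFin-*ʳ : ∀ {d} x (f : Fin d → K) → ΣFin f * x ≈ ΣFin (λ k → f k * x)
  ΣFin-*ʳ x f = begin
    ΣFin f * x              ≡⟨ ≡.cong (_* x) (ΣFin≡sum f) ⟩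
    sum f * x               ≈⟨ *-distribʳ-sum x f ⟩
    sum (λ k → f k * x)     ≡⟨ ΣFin≡sum (λ k → f k * x) ⟨
    ΣFin (λ k → f k * x)    ∎

  ΣFin-comm : ∀ {d e} (f : Fin d → Fin e → K) →
              ΣFin (λ i → ΣFin (f i)) ≈ ΣFin (λ j → ΣFin (λ i → f i j))
  ΣFin-comm f = begin
    ΣFin (λ i → ΣFin (f i))                ≡⟨ ΣFin≡sum (λ i → ΣFin (f i)) ⟩
    sum (λ i → ΣFin (f i))                 ≈⟨ sum-cong-≋ (λ i → reflexive (ΣFin≡sum (f i))) ⟩
    sum (λ i → sum (f i))                  ≈⟨ ∑-comm f ⟩
    sum (λ j → sum (λ i → f i j))          ≈⟨ sum-cong-≋ (λ j → reflexive (ΣFin≡sum (λ i → f i j))) ⟨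
    sum (λ j → ΣFin (λ i → f i j))         ≡⟨ ΣFin≡sum (λ j → ΣFin (λ i → f i j)) ⟨
    ΣFin (λ j → ΣFin (λ i → f i j))        ∎

  ΣUpTo-zero : ∀ n (h : ℕ → K) → (∀ k → k ≤ n → h k ≈ 0#) → ΣUpTo n h ≈ 0#
  ΣUpTo-zero n h h≈0 = ΣFin-zero (λ k → h≈0 (toℕ k) (ℕP.≤-pred (FinP.toℕ<n k)))

  ΣUpTo-single : ∀ n (h : ℕ → K) m → m ≤ n →
                 (∀ k → k ≤ n → k ≢ m → h k ≈ 0#) → ΣUpTo n h ≈ h m
  ΣUpTo-single n h m m≤n off = begin
    ΣUpTo n h            ≈⟨ ΣFin-single m′ (λ k k≢m′ → off (toℕ k) (ℕP.≤-pred (FinP.toℕ<n k)) (k≢m′ ∘ toℕ≡m)) ⟩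
    h (toℕ m′)           ≡⟨ ≡.cong h (FinP.toℕ-fromℕ< (s≤s m≤n)) ⟩
    h m                  ∎
    where
    m′ : Fin (suc n)
    m′ = fromℕ< (s≤s m≤n)
    toℕ≡m : ∀ {k} → toℕ k ≡ m → k ≡ m′
    toℕ≡m e = FinP.toℕ-injective (≡.trans e (≡.sym (FinP.toℕ-fromℕ< (s≤s m≤n))))

  u^-on : ∀ s → u^ s s ≈ 1#
  u^-on s with s ≡ᵇ s in e
  ... | true  = refl
  ... | false = contradiction (ℕP.≡⇒≡ᵇ s s ≡.refl) (≡.subst T e)

  u^-off : ∀ s n → n ≢ s → u^ s n ≈ 0#
  u^-off s n n≢s with n ≡ᵇ s in e
  ... | true  = contradiction (ℕP.≡ᵇ⇒≡ n s (≡.subst T (≡.sym e) tt)) n≢s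
  ... | false = refl

  ·const-coeff : ∀ (f : Seq) a n → (f ·ₚ const a) n ≈ f n * a
  ·const-coeff f a n = begin
    (f ·ₚ const a) n               ≈⟨ ΣUpTo-single n _ n ℕP.≤-refl off ⟩
    f n * const a (n ℕ.∸ n)        ≡⟨ ≡.cong (λ m → f n * const a m) (ℕP.n∸n≡0 n) ⟩
    f n * a                        ∎
    where
    const-pos : ∀ k m → 0 < m → f k * const a m ≈ 0#
    const-pos k (suc m) _ = zeroʳ (f k)
    off : ∀ k → k ≤ n → k ≢ n → f k * const a (n ℕ.∸ k) ≈ 0#
    off k k≤n k≢n = const-pos k _ (ℕP.m<n⇒0<n∸m (ℕP.≤∧≢⇒< k≤n k≢n))

  ∣ₚ-low : ∀ {f : Seq} {s} → u^ s ∣ₚ f → ∀ {n} → n < s → f n ≈ 0#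
  ∣ₚ-low {f} {s} (h , _ , f≈u^s·h) {n} n<s = trans (f≈u^s·h n)
    (ΣUpTo-zero n (λ k → u^ s k * h (n ℕ.∸ k)) (λ k k≤n →
      trans (*-congʳ (u^-off s k (λ k≡s → ℕP.<-irrefl k≡s (ℕP.≤-<-trans k≤n n<s)))) (zeroˡ _)))

  const-isPoly : ∀ a → IsPoly (const a)
  const-isPoly a = 1 , λ { (suc n) _ → refl }

  const-zero : ∀ {a} → a ≈ 0# → const a ≈ₚ 0ₚ
  const-zero a≈0 zero    = a≈0
  const-zero a≈0 (suc n) = refl

  idM-diag : ∀ {d} (j : Fin d) → idM j j ≈ 1#
  idM-diag j with j F.≟ j
  ... | yes _    = refl
  ... | no j≢j   = contradiction ≡.refl j≢j

  idM-off : ∀ {d} {i j : Fin d} → i ≢ j → idM i j ≈ 0#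
  idM-off {i = i} {j} i≢j with i F.≟ j
  ... | yes i≡j = contradiction i≡j i≢j
  ... | no _    = refl

  _ᵛ·_ : ∀ {d} → (Fin d → K) → Mat d → Fin d → K
  (w ᵛ· A) l = ΣFin (λ k → w k * A k l)

  ΣFin-δ : ∀ {d} (w : Fin d → K) j → ΣFin (λ k → w k * idM k j) ≈ w j
  ΣFin-δ w j = trans (ΣFin-single j (λ k k≢j → trans (*-congˡ (idM-off k≢j)) (zeroʳ _)))
                     (trans (*-congˡ (idM-diag j)) (*-identityʳ _))

  ·PA-coeff : ∀ {d} (X : PMat d) (A : Mat d) r l n →
              (X ·PA A) r l n ≈ ((λ k → X r k n) ᵛ· A) l
  ·PA-coeff X A r l n = ΣFin-cong (λ k → ·const-coeff (X r k) (A k l) n)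

  module _ {d : ℕ} {p : Level} where

    𝟙 : {P : Pred (Fin d) p} → Decidable P → Fin d → K
    𝟙 P? k = if does (P? k) then 1# else 0#

    𝟙-in : ∀ {P : Pred (Fin d) p} (P? : Decidable P) {k} → P k → 𝟙 P? k ≈ 1#
    𝟙-in P? {k} Pk with P? k
    ... | yes _   = refl
    ... | no ¬Pk  = contradiction Pk ¬Pk

    𝟙-out : ∀ {P : Pred (Fin d) p} (P? : Decidable P) {k} → ¬ P k → 𝟙 P? k ≈ 0#
    𝟙-out P? {k} ¬Pk with P? k
    ... | yes Pk = contradiction Pk ¬Pk
    ... | no _   = refl

    𝟙-kills : ∀ {P : Pred (Fin d) p} (P? : Decidable P) k {x} →
              (P k → x ≈ 0#) → 𝟙 P? k * x ≈ 0#
    𝟙-kills P? k x≈0 with P? k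
    ... | yes Pk = trans (*-identityˡ _) (x≈0 Pk)
    ... | no _   = zeroˡ _

    𝟙-cong : ∀ {P Q : Pred (Fin d) p} (P? : Decidable P) (Q? : Decidable Q) {k} →
             (P k → Q k) → (Q k → P k) → 𝟙 P? k ≈ 𝟙 Q? k
    𝟙-cong P? Q? {k} P⇒Q Q⇒P with P? k
    ... | yes Pk = sym (𝟙-in Q? (P⇒Q Pk))
    ... | no ¬Pk = sym (𝟙-out Q? (λ Qk → ¬Pk (Q⇒P Qk)))

    -- N inverts the principal submatrix of A on P:  Σ_{k∈P} A i k N k j = δ i j
    InverseOn : {P : Pred (Fin d) p} → Decidable P → Mat d → Mat d → Set (p ⊔ ℓ)
    InverseOn {P} P? A N = ∀ i j → P i → P j →
                           ΣFin (λ k → 𝟙 P? k * (A i k * N k j)) ≈ idM i j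

    SupportedOn : Pred (Fin d) p → (Fin d → K) → Set (p ⊔ ℓ)
    SupportedOn P w = ∀ k → ¬ P k → w k ≈ 0#

    InverseOn-full : ∀ {P : Pred (Fin d) p} (P? : Decidable P) {A B : Mat d} →
                     (A ·M B) ≈M idM → (∀ k → P k) → InverseOn P? A B
    InverseOn-full P? {A} {B} AB≈I all i j _ _ = begin
      ΣFin (λ k → 𝟙 P? k * (A i k * B k j)) ≈⟨ ΣFin-cong (λ k → trans (*-congʳ (𝟙-in P? (all k))) (*-identityˡ _)) ⟩
      (A ·M B) i j                          ≈⟨ AB≈I i j ⟩
      idM i j                               ∎

    InverseOn-cong : ∀ {P Q : Pred (Fin d) p} (P? : Decidable P) (Q? : Decidable Q) →
                     (∀ k → P k → Q k) → (∀ k → Q k → P k) →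
                     ∀ {A N} → InverseOn P? A N → InverseOn Q? A N
    InverseOn-cong P? Q? P⇒Q Q⇒P inv i j Qi Qj =
      trans (ΣFin-cong (λ k → *-congʳ (𝟙-cong Q? P? (Q⇒P k) (P⇒Q k)))) (inv i j (Q⇒P i Qi) (Q⇒P j Qj))

    _∖?_ : ∀ {P : Pred (Fin d) p} → Decidable P → (m : Fin d) → Decidable (λ k → P k × k ≢ m)
    (P? ∖? m) k = P? k ×-dec ¬? (k F.≟ m)

    module _ {P : Pred (Fin d) p} (P? : Decidable P) {A N : Mat d}
             (inv : InverseOn P? A N) where

      recover : ∀ w → SupportedOn P w → ∀ j → P j →
                w j ≈ ΣFin (λ l → 𝟙 P? l * ((w ᵛ· A) l * N l j))
      recover w supp j Pj = sym (begin
        ΣFin (λ l → 𝟙 P? l * ((w ᵛ· A) l * N l j))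
          ≈⟨ ΣFin-cong expand ⟩
        ΣFin (λ l → ΣFin (λ k → w k * (𝟙 P? l * (A k l * N l j))))
          ≈⟨ ΣFin-comm (λ l k → w k * (𝟙 P? l * (A k l * N l j))) ⟩
        ΣFin (λ k → ΣFin (λ l → w k * (𝟙 P? l * (A k l * N l j))))
          ≈⟨ ΣFin-cong (λ k → sym (ΣFin-*ˡ (w k) (λ l → 𝟙 P? l * (A k l * N l j)))) ⟩
        ΣFin (λ k → w k * ΣFin (λ l → 𝟙 P? l * (A k l * N l j)))
          ≈⟨ ΣFin-cong invert ⟩
        ΣFin (λ k → w k * idM k j)
          ≈⟨ ΣFin-δ w j ⟩
        w j ∎)
        where
        expand : ∀ l → 𝟙 P? l * ((w ᵛ· A) l * N l j) ≈ ΣFin (λ k → w k * (𝟙 P? l * (A k l * N l j)))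
        expand l = trans (*-congˡ (ΣFin-*ʳ (N l j) (λ k → w k * A k l)))
                  (trans (ΣFin-*ˡ (𝟙 P? l) (λ k → (w k * A k l) * N l j)) (ΣFin-cong (λ k → reassoc (𝟙 P? l) (w k) (A k l) (N l j))))
        invert : ∀ k → w k * ΣFin (λ l → 𝟙 P? l * (A k l * N l j)) ≈ w k * idM k j
        invert k with P? k
        ... | yes Pk = *-congˡ (inv k j Pk Pj)
        ... | no ¬Pk = trans (*-congʳ (supp k ¬Pk)) (trans (zeroˡ _) (sym (trans (*-congʳ (supp k ¬Pk)) (zeroˡ _))))

      vanishing : ∀ w → SupportedOn P w → (∀ l → P l → (w ᵛ· A) l ≈ 0#) → ∀ j → w j ≈ 0#
      vanishing w supp wA≈0 j with P? j
      ... | no ¬Pj = supp j ¬Pj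
      ... | yes Pj = trans (recover w supp j Pj)
                       (ΣFin-zero (λ l → 𝟙-kills P? l (λ Pl → trans (*-congʳ (wA≈0 l Pl)) (zeroˡ _))))

      -- Removing one index: if w is supported on P, w m = 1 and (w A)ₗ = 0 on
      -- P ∖ {m}, then a rank-one correction of N inverts A on P ∖ {m}.
      removeIndex : ∀ m w → P m → SupportedOn P w → w m ≈ 1# →
                    (∀ l → P l → l ≢ m → (w ᵛ· A) l ≈ 0#) →
                    ∃ λ N′ → InverseOn (P? ∖? m) A N′
      removeIndex m w Pm supp wm≈1 wA≈0 = N′ , inverts
        where
        γ : K
        γ = (w ᵛ· A) m

        -- only the index m survives in the recovery formula for w
        w≈γN : ∀ j → P j → w j ≈ γ * N m j
        w≈γN j Pj = trans (recover w supp j Pj) (trans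
          (ΣFin-single m (λ l l≢m → 𝟙-kills P? l (λ Pl → trans (*-congʳ (wA≈0 l Pl l≢m)) (zeroˡ _))))
          (trans (*-congʳ (𝟙-in P? Pm)) (*-identityˡ _)))

        γN≈1 : γ * N m m ≈ 1#
        γN≈1 = trans (sym (w≈γN m Pm)) wm≈1

        N′ : Mat d
        N′ i j = N i j - N i m * (γ * N m j)

        -- the corrected column m is cancelled exactly by γ N m m = 1
        cancel : ∀ a x → a * x + (a * N m m) * (- (γ * x)) ≈ 0#
        cancel a x = begin
          a * x + (a * N m m) * (- (γ * x)) ≈⟨ +-congˡ (swap-neg a x (N m m) γ) ⟩
          a * x - (a * x) * (γ * N m m)     ≈⟨ +-congˡ (-‿cong (trans (*-congˡ γN≈1) (*-identityʳ _))) ⟩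
          a * x - a * x                     ≈⟨ -‿inverseʳ _ ⟩
          0#                                ∎

        -- termwise: the correction contributes -γ N m j times column m of the
        -- old product; at k = m both sides vanish
        term : ∀ i j k → 𝟙 (P? ∖? m) k * (A i k * N′ k j) ≈
               𝟙 P? k * (A i k * N k j) + (𝟙 P? k * (A i k * N k m)) * (- (γ * N m j))
        term i j k with m F.≟ k
        ... | no m≢k = trans (*-congʳ (𝟙-cong (P? ∖? m) P? proj₁ (_, m≢k ∘ ≡.sym))) (split _ _ _ _ _)
        ... | yes ≡.refl = begin
          𝟙 (P? ∖? m) m * (A i m * N′ m j)
            ≈⟨ trans (*-congʳ (𝟙-out (P? ∖? m) (λ (_ , m≢m) → m≢m ≡.refl))) (zeroˡ _) ⟩
          0#
            ≈⟨ sym (cancel (A i m) (N m j)) ⟩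
          A i m * N m j + (A i m * N m m) * (- (γ * N m j))
            ≈⟨ sym (+-cong (*-identityˡ _) (*-congʳ (*-identityˡ _))) ⟩
          1# * (A i m * N m j) + (1# * (A i m * N m m)) * (- (γ * N m j))
            ≈⟨ sym (+-cong (*-congʳ (𝟙-in P? Pm)) (*-congʳ (*-congʳ (𝟙-in P? Pm)))) ⟩
          𝟙 P? m * (A i m * N m j) + (𝟙 P? m * (A i m * N m m)) * (- (γ * N m j)) ∎

        inverts : InverseOn (P? ∖? m) A N′
        inverts i j (Pi , i≢m) (Pj , _) = begin
          ΣFin (λ k → 𝟙 (P? ∖? m) k * (A i k * N′ k j))
            ≈⟨ ΣFin-cong (term i j) ⟩
          ΣFin (λ k → 𝟙 P? k * (A i k * N k j) + (𝟙 P? k * (A i k * N k m)) * corr)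
            ≈⟨ ΣFin-+ (λ k → 𝟙 P? k * (A i k * N k j)) (λ k → (𝟙 P? k * (A i k * N k m)) * corr) ⟩
          ΣFin (λ k → 𝟙 P? k * (A i k * N k j)) + ΣFin (λ k → (𝟙 P? k * (A i k * N k m)) * corr)
            ≈⟨ +-congˡ (sym (ΣFin-*ʳ corr (λ k → 𝟙 P? k * (A i k * N k m)))) ⟩
          ΣFin (λ k → 𝟙 P? k * (A i k * N k j)) + ΣFin (λ k → 𝟙 P? k * (A i k * N k m)) * corr
            ≈⟨ +-cong (inv i j Pi Pj) (*-congʳ (inv i m Pi Pm)) ⟩
          idM i j + idM i m * corr
            ≈⟨ +-congˡ (trans (*-congʳ (idM-off i≢m)) (zeroˡ corr)) ⟩
          idM i j + 0#
            ≈⟨ +-identityʳ _ ⟩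
          idM i j ∎
          where
          corr : K
          corr = - (γ * N m j)

  module Setting (d : ℕ) (t : Fin d → ℕ) (t-inj : Injective _≡_ _≡_ t) (X : PMat d)
                 (lower : ∀ i j → j F.< i → X i j ≈ₚ 0ₚ)
                 (diag : ∀ i → X i i ≈ₚ u^ (t i))
                 (deg : ∀ i j → i F.< j → DegLt (X i j) (t j))
                 (A B : Mat d) (AB≈I : (A ·M B) ≈M idM)
                 (div : ∀ i r → u^ (t i) ∣ₚ (X ·PA A) r i) where

    row : Fin d → ℕ → Fin d → K
    row i n k = X i k n

    row-offDiag : ∀ i n k → k ≢ i → t k ≤ n → row i n k ≈ 0#
    row-offDiag i n k k≢i tk≤n with FinP.<-cmp i k
    ... | tri< i<k _ _   = deg i k i<k n tk≤n
    ... | tri≈ _ i≡k _   = contradiction (≡.sym i≡k) k≢i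
    ... | tri> _ _ k<i   = lower i k k<i n

    rowA-low : ∀ r n l → n < t l → (row r n ᵛ· A) l ≈ 0#
    rowA-low r n l n<tl = trans (sym (·PA-coeff X A r l n)) (∣ₚ-low (div l r) n<tl)

    Above : ℕ → Pred (Fin d) 0ℓ
    Above n k = n ≤ t k

    Above? : ∀ n → Decidable (Above n)
    Above? n k = n ≤? t k

    inverseAbove-skip : ∀ n → ¬ (∃ λ m → t m ≡ n) → ∀ {N} →
                        InverseOn (Above? n) A N → InverseOn (Above? (suc n)) A N
    inverseAbove-skip n none = InverseOn-cong (Above? n) (Above? (suc n))
      (λ k n≤tk → ℕP.≤∧≢⇒< n≤tk (λ n≡tk → none (k , ≡.sym n≡tk)))
      (λ k → ℕP.<⇒≤)

    -- The index m leaves: row m (t m) is the vector that removeIndex needs.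
    inverseAbove-remove : ∀ m {N} → InverseOn (Above? (t m)) A N →
                          ∃ λ N′ → InverseOn (Above? (suc (t m))) A N′
    inverseAbove-remove m inv =
      let N′ , inv′ = removeIndex (Above? (t m)) inv m (row m (t m)) ℕP.≤-refl supp
                        (trans (diag m (t m)) (u^-on (t m))) kills
      in N′ , InverseOn-cong (Above? (t m) ∖? m) (Above? (suc (t m))) above⇒ ⇒above inv′
      where
      supp : SupportedOn (Above (t m)) (row m (t m))
      supp k tm≰tk = row-offDiag m (t m) k (λ { ≡.refl → tm≰tk ℕP.≤-refl }) (ℕP.<⇒≤ (ℕP.≰⇒> tm≰tk))
      above⇒ : ∀ k → t m ≤ t k × k ≢ m → suc (t m) ≤ t k
      above⇒ k (tm≤tk , k≢m) = ℕP.≤∧≢⇒< tm≤tk (λ tm≡tk → k≢m (t-inj (≡.sym tm≡tk)))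
      ⇒above : ∀ k → suc (t m) ≤ t k → t m ≤ t k × k ≢ m
      ⇒above k tm<tk = ℕP.<⇒≤ tm<tk , λ { ≡.refl → ℕP.<-irrefl ≡.refl tm<tk }
      kills : ∀ l → t m ≤ t l → l ≢ m → (row m (t m) ᵛ· A) l ≈ 0#
      kills l tm≤tl l≢m = rowA-low m (t m) l (above⇒ l (tm≤tl , l≢m))

    inverseAbove : ∀ n → ∃ λ N → InverseOn (Above? n) A N
    inverseAbove zero = B , InverseOn-full (Above? zero) AB≈I (λ _ → z≤n)
    inverseAbove (suc n) with inverseAbove n | FinP.any? (λ m → t m ℕ.≟ n)
    ... | N , inv | yes (m , ≡.refl) = inverseAbove-remove m inv
    ... | N , inv | no none         = N , inverseAbove-skip n none inv

    row-vanishes : ∀ i n → n ≢ t i → ∀ k → row i n k ≈ 0#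
    row-vanishes i n n≢ti = vanishing (Above? (suc n)) (proj₂ (inverseAbove (suc n)))
      (row i n) supp (λ l → rowA-low i n l)
      where
      supp : SupportedOn (Above (suc n)) (row i n)
      supp k n≮tk with k F.≟ i
      ... | yes ≡.refl = trans (diag i n) (u^-off (t i) n n≢ti)
      ... | no k≢i     = row-offDiag i n k k≢i (ℕP.≮⇒≥ n≮tk)

    entry-monomial : ∀ i j → X i j ≈ₚ (u^ (t i) ·ₚ const (X i j (t i)))
    entry-monomial i j n with n ℕ.≟ t i
    ... | yes ≡.refl = sym (trans (·const-coeff (u^ n) _ n) (trans (*-congʳ (u^-on n)) (*-identityˡ _)))
    ... | no n≢ti    = trans (row-vanishes i n n≢ti j)
                         (sym (trans (·const-coeff (u^ (t i)) _ n) (trans (*-congʳ (u^-off (t i) n n≢ti)) (zeroˡ _))))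

lemma4p3 : ∀ {c ℓ} (R : CommutativeRing c ℓ) → let open Over R in
    IsField → IsFinite → (p : ℕ) → HasChar p →
    (d : ℕ) (t : Fin d → ℕ) → (∀ i → t i ≤ p) → Injective _≡_ _≡_ t →
    (X : PMat d) → (∀ i j → IsPoly (X i j)) →
    (∀ i j → j F.< i → X i j ≈ₚ 0ₚ) →
    (∀ i → X i i ≈ₚ u^ (t i)) →
    (∀ i j → i F.< j → DegLt (X i j) (t j)) →
    (A : Mat d) → IsInvertible A →
    (∀ i r → u^ (t i) ∣ₚ (X ·PA A) r i) →
    ∀ i j → i F.< j →
    ∃ λ y → IsPoly y × (X i j ≈ₚ (u^ (t i) ·ₚ y))
    × (t j ℕ.< t i → y ≈ₚ 0ₚ)
    × (t i ℕ.< t j → ∃ λ a → y ≈ₚ const a)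
lemma4p3 R _ _ _ _ d t _ t-inj X _ lower diag deg A (B , AB≈I , _) div i j i<j =
  const a , const-isPoly a , entry-monomial i j , y≈0 , λ _ → a , λ _ → refl
  where
  open CommutativeRing R using (Carrier; refl)
  open Over R
  open Development R
  open Setting d t t-inj X lower diag deg A B AB≈I div
  a : Carrier
  a = X i j (t i)
  -- if t j < t i then deg x_{ij} < t j ≤ t i kills that coefficient
  y≈0 : t j ℕ.< t i → const a ≈ₚ 0ₚ
  y≈0 tj<ti = const-zero (deg i j i<j (t i) (ℕP.<⇒≤ tj<ti))
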